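{- Let $C_{13}(1,3)$ be the graph with vertex set $\{v_0,\dots,v_{12}\}$ and edge set $\{v_iv_{i+1}\}_{0\le i\le 12}\cup\{v_iv_{i+3}\}_{0\le i\le 12}$, indices modulo $13$. If $\sigma$ is a total $5$-colouring of $C_{13}(1,3)$ with colours $1,\dots,5$ labelled so that $|V_1|\ge |V_2|\ge\cdots\ge|V_5|$, where $V_j$ is the set of vertices coloured $j$, then $|V_1|=|V_2|=|V_3|=|V_4|=3$ and $|V_5|=1$.
   Context: A total $5$-colouring of a simple graph $G$ is a map $\sigma: V(G)\cup E(G)\to\{1,\dots,5\}$ such that adjacent vertices receive distinct colours, adjacent edges receive distinct colours, and each vertex receives a colour different from those of its incident edges. The paper adopts the convention that colours are indexed so that the vertex colour classes have non-increasing sizes. -}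

module Defs where

open import Data.Nat using (ℕ; _≥_; _+_)
open import Data.Nat.DivMod using (_%_)
open import Data.Fin using (Fin; toℕ; fromℕ<)
open import Data.Fin.Properties using (_≟_)
open import Data.Nat.DivMod using (m%n<n)
open import Data.Product using (_×_; _,_; proj₁; proj₂)
open import Data.Sum using (_⊎_)
open import Data.List using (List; length; filter)
open import Data.List using (allFin)
open import Relation.Binary.PropositionalEquality using (_≡_)
open import Relation.Nullary using (¬_)

Vertex : Set
Vertex = Fin 13

_⊕_ : Vertex → ℕ → Vertex
i ⊕ k = fromℕ< (m%n<n (toℕ i + k) 13)

data Step : Set where
  one three : Step

stepℕ : Step → ℕ
stepℕ one   = 1
stepℕ three = 3

-- Edges: (i , s) is the edge v_i v_{i+s}.  Since 13 > 2·3, these 26 pairs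
-- are exactly the 26 distinct edges of C_13(1,3).
Edge : Set
Edge = Vertex × Step

end₁ end₂ : Edge → Vertex
end₁ (i , s) = i
end₂ (i , s) = i ⊕ stepℕ s

Incident : Vertex → Edge → Set
Incident v e = (v ≡ end₁ e) ⊎ (v ≡ end₂ e)

Adjacent : Vertex → Vertex → Set
Adjacent u v = Data.Product.Σ Edge (λ e → (u ≡ end₁ e × v ≡ end₂ e) ⊎ (v ≡ end₁ e × u ≡ end₂ e))

AdjacentEdges : Edge → Edge → Set
AdjacentEdges e f = ¬ (e ≡ f) × Data.Product.Σ Vertex (λ v → Incident v e × Incident v f)

Colour : Set
Colour = Fin 5

record Total5Colouring : Set where
  field
    vcol : Vertex → Colour
    ecol : Edge → Colour
    vertexProper : ∀ u v → Adjacent u v → ¬ (vcol u ≡ vcol v)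
    edgeProper   : ∀ e f → AdjacentEdges e f → ¬ (ecol e ≡ ecol f)
    incidProper  : ∀ v e → Incident v e → ¬ (vcol v ≡ ecol e)
open Total5Colouring public

classSize : Total5Colouring → Colour → ℕ
classSize σ j = length (filter (λ v → vcol σ v ≟ j) (allFin 13))

-- At each vertex v, v itself and its four incident edges are pairwise adjacent or incident,
-- so this star carries all five colours, each exactly once.  Double counting these stars
-- gives |V_j| + 2|E_j| = 13 for every colour j, so |V_j| is odd.  V_j is independent, and no
-- vertex has all four neighbours in V_j, since its star would then miss the colour j; a finite
-- search shows that such sets have at most four vertices.  Hence every |V_j| is 1 or 3, and
-- five such numbers in non-increasing order summing to 13 are 3, 3, 3, 3, 1.

module Submission where

open import Defs
open import Data.Nat using (ℕ; _≥_)
open import Data.Fin using (zero; suc)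
open import Data.Product using (_×_)
open import Relation.Binary.PropositionalEquality using (_≡_)

open import Data.Bool using (true; false; if_then_else_)
open import Data.Fin using (Fin; punchOut)
open import Data.Fin.Patterns using (0F; 1F; 2F; 3F; 4F)
open import Data.Fin.Permutation using (Permutation; permutation)
open import Data.Fin.Properties using (_≟_; all?; any?; pigeonhole; punchOut-injective; 0≢1+n; <-irrefl)
  renaming (suc-injective to Fin-suc-injective)
open import Data.Fin.Subset using (Subset; _∈_; ∣_∣)
open import Data.Fin.Subset.Properties using (_∈?_; anySubset?)
open import Data.List using (length; filter) renaming (tabulate to tabulateL)
open import Data.Nat using (zero; suc; _+_; _*_; _∸_; _<_; _≤_; s≤s)
open import Data.Nat.Properties using (+-0-commutativeMonoid; even≢odd; suc-injective; _<?_; ≮⇒≥; n<1+n)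
open import Data.Nat.Tactic.RingSolver using (solve-∀)
open import Data.Product using (_,_; ∃; proj₁; proj₂)
open import Data.Sum using (_⊎_; inj₁; inj₂)
open import Data.Vec using (Vec; []; _∷_; lookup; tabulate)
open import Data.Vec.Properties using ([]=⇒lookup; lookup∘tabulate)
open import Data.Vec.Relation.Unary.AllPairs using ([]; _∷_)
open import Data.Vec.Relation.Unary.All using ([]; _∷_)
open import Data.Vec.Relation.Unary.Unique.Propositional using (Unique)
open import Data.Vec.Relation.Unary.Unique.Propositional.Properties using (lookup-injective)
open import Function using (_∘_; id; Injective)
open import Level using (Level)
open import Relation.Binary.PropositionalEquality using (refl; sym; trans; subst; cong; cong₂; _≢_; module ≡-Reasoning)
open import Relation.Nullary using (¬_; Dec; yes; no; does; proof; Reflects; invert; ¬?; _×-dec_; contradiction)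
open import Relation.Nullary.Decidable using (from-yes; from-no; map′)
open import Relation.Unary using (Pred; Decidable)

open import Algebra.Properties.CommutativeMonoid.Sum +-0-commutativeMonoid
  using (sum-syntax; sum-cong-≗; sum-replicate-zero; ∑-comm; sum-permute)

private
  variable
    ℓ : Level
    A : Set
    P : Set ℓ
    m n : ℕ

[_] : Dec P → ℕ
[ P? ] = if does P? then 1 else 0

[]-yes : (P? : Dec P) → P → [ P? ] ≡ 1
[]-yes (yes _) _ = refl
[]-yes (no ¬p) p = contradiction p ¬p

[]-no : (P? : Dec P) → ¬ P → [ P? ] ≡ 0
[]-no (yes p) ¬p = contradiction p ¬p
[]-no (no _) _ = refl

length-filter-tabulate : {Q : Pred A ℓ} (Q? : Decidable Q) (f : Fin n → A) →
                         length (filter Q? (tabulateL f)) ≡ ∑[ i < n ] [ Q? (f i) ]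
length-filter-tabulate {n = zero} Q? f = refl
length-filter-tabulate {n = suc n} Q? f with does (Q? (f zero))
... | true  = cong suc (length-filter-tabulate Q? (f ∘ suc))
... | false = length-filter-tabulate Q? (f ∘ suc)

∣tabulate∣ : {Q : Pred (Fin n) ℓ} (Q? : Decidable Q) → ∣ tabulate (does ∘ Q?) ∣ ≡ ∑[ i < n ] [ Q? i ]
∣tabulate∣ {n = zero} Q? = refl
∣tabulate∣ {n = suc n} Q? with does (Q? zero)
... | true  = cong suc (∣tabulate∣ (Q? ∘ suc))
... | false = ∣tabulate∣ (Q? ∘ suc)

∈-tabulate⁻ : {Q : Pred (Fin n) ℓ} (Q? : Decidable Q) → ∀ {i} → i ∈ tabulate (does ∘ Q?) → Q i
∈-tabulate⁻ Q? {i} i∈ = invert (subst (Reflects _) does≡true (proof (Q? i)))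
  where
  does≡true : does (Q? i) ≡ true
  does≡true = trans (sym (lookup∘tabulate (does ∘ Q?) i)) ([]=⇒lookup i∈)

∑[i≟j]≡1 : (i : Fin n) → ∑[ j < n ] [ i ≟ j ] ≡ 1
∑[i≟j]≡1 {suc n} zero = cong suc (sum-replicate-zero n)
∑[i≟j]≡1 (suc i)      = ∑[i≟j]≡1 i

injective⇒surjective : {f : Fin n → Fin n} → Injective _≡_ _≡_ f → ∀ j → ∃ λ i → f i ≡ j
injective⇒surjective {n = suc n} {f} inj j with any? (λ i → f i ≟ j)
... | yes hit = hit
... | no miss =
  let i , k , i<k , eq = pigeonhole (n<1+n n) (λ i → punchOut (j≢f i))
  in contradiction (inj (punchOut-injective (j≢f i) (j≢f k) eq)) (λ i≡k → <-irrefl i≡k i<k)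
  where
  j≢f : ∀ i → j ≢ f i
  j≢f i j≡fi = miss (i , sym j≡fi)

∑[fk≟j]≡1 : {f : Fin m → Fin n} → Injective _≡_ _≡_ f → ∀ {i j} → f i ≡ j → ∑[ k < m ] [ f k ≟ j ] ≡ 1
∑[fk≟j]≡1 {suc m} {f = f} inj {zero} {j} f0≡j = cong₂ _+_ ([]-yes (f zero ≟ j) f0≡j) (begin
  ∑[ k < m ] [ f (suc k) ≟ j ] ≡⟨ sum-cong-≗ (λ k → []-no (f (suc k) ≟ j) (fsk≢j k)) ⟩
  ∑[ k < m ] 0                 ≡⟨ sum-replicate-zero m ⟩
  0                            ∎)
  where
  open ≡-Reasoning
  fsk≢j : ∀ k → f (suc k) ≢ j
  fsk≢j k fsk≡j = 0≢1+n (inj (trans f0≡j (sym fsk≡j)))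
∑[fk≟j]≡1 {f = f} inj {suc i} {j} fi≡j = cong₂ _+_
  ([]-no (f zero ≟ j) (λ f0≡j → 0≢1+n (inj (trans f0≡j (sym fi≡j)))))
  (∑[fk≟j]≡1 (Fin-suc-injective ∘ inj) fi≡j)

injective⇒∑[fk≟j]≡1 : {f : Fin n → Fin n} → Injective _≡_ _≡_ f → ∀ j → ∑[ k < n ] [ f k ≟ j ] ≡ 1
injective⇒∑[fk≟j]≡1 inj j = ∑[fk≟j]≡1 inj (proj₂ (injective⇒surjective inj j))

all-steps? : {Q : Step → Set ℓ} → Decidable Q → Dec (∀ s → Q s)
all-steps? Q? = map′ (λ { (q₁ , q₃) one → q₁ ; (q₁ , q₃) three → q₃ }) (λ q → q one , q three)
                     (Q? one ×-dec Q? three)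

_⊖_ : Vertex → Step → Vertex
v ⊖ s = v ⊕ (13 ∸ stepℕ s)

⊖-⊕ : ∀ s v → (v ⊖ s) ⊕ stepℕ s ≡ v
⊖-⊕ = from-yes (all-steps? λ s → all? λ v → (v ⊖ s) ⊕ stepℕ s ≟ v)

⊕-⊖ : ∀ s v → (v ⊕ stepℕ s) ⊖ s ≡ v
⊕-⊖ = from-yes (all-steps? λ s → all? λ v → (v ⊕ stepℕ s) ⊖ s ≟ v)

⊖-irrefl : ∀ s v → v ≢ v ⊖ s
⊖-irrefl = from-yes (all-steps? λ s → all? λ v → ¬? (v ≟ v ⊖ s))

rotation : Step → Permutation 13 13
rotation s = permutation (_⊖ s) (_⊕ stepℕ s) (⊕-⊖ s) (⊖-⊕ s)

∑-⊖ : ∀ s (g : Vertex → ℕ) → ∑[ v < 13 ] g (v ⊖ s) ≡ ∑[ v < 13 ] g v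
∑-⊖ s g = sym (sum-permute g (rotation s))

Independent : Subset 13 → Set
Independent X = ∀ v s → ¬ (v ∈ X × v ⊕ stepℕ s ∈ X)

Surrounds : Subset 13 → Vertex → Set
Surrounds X v = ∀ s → v ⊕ stepℕ s ∈ X × v ⊖ s ∈ X

independent? : Decidable Independent
independent? X = all? λ v → all-steps? λ s → ¬? (v ∈? X ×-dec v ⊕ stepℕ s ∈? X)

surrounds? : ∀ X → Decidable (Surrounds X)
surrounds? X v = all-steps? λ s → v ⊕ stepℕ s ∈? X ×-dec v ⊖ s ∈? X

-- There are no independent 6-sets, and the independent 5-sets are the rotations of
-- {v₀, v₂, v₄, v₆, v₈}, which surround v₃.
∣independent-non-surrounding∣≤4 : ∀ X → Independent X → (∀ v → ¬ Surrounds X v) → ∣ X ∣ ≤ 4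
∣independent-non-surrounding∣≤4 X indep unsurrounded = ≮⇒≥ λ large → no-counterexample (X , large , indep , unsurrounded)
  where
  no-counterexample : ¬ ∃ λ X → 4 < ∣ X ∣ × Independent X × (∀ v → ¬ Surrounds X v)
  no-counterexample = from-no (anySubset? λ X →
    4 <? ∣ X ∣ ×-dec independent? X ×-dec all? λ v → ¬? (surrounds? X v))

star : Total5Colouring → Vertex → Vec Colour 5
star σ v = vcol σ v ∷ ecol σ (v , one) ∷ ecol σ (v ⊖ one , one) ∷ ecol σ (v , three) ∷ ecol σ (v ⊖ three , three) ∷ []

module _ (σ : Total5Colouring) (v : Vertex) where
  private
    out : ∀ s → Incident v (v , s)
    out s = inj₁ refl

    into : ∀ s → Incident v (v ⊖ s , s)
    into s = inj₂ (sym (⊖-⊕ s v))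

    opposite : ∀ s → (v , s) ≢ (v ⊖ s , s)
    opposite s = ⊖-irrefl s v ∘ cong proj₁

    vertex≢edge : ∀ {e} → Incident v e → vcol σ v ≢ ecol σ e
    vertex≢edge = incidProper σ v _

    edge≢edge : ∀ {e f} → Incident v e → Incident v f → e ≢ f → ecol σ e ≢ ecol σ f
    edge≢edge ie if e≢f = edgeProper σ _ _ (e≢f , v , ie , if)

  star-unique : Unique (star σ v)
  star-unique =
      (vertex≢edge (out one) ∷ vertex≢edge (into one) ∷ vertex≢edge (out three) ∷ vertex≢edge (into three) ∷ [])
    ∷ (edge≢edge (out one) (into one) (opposite one) ∷ edge≢edge (out one) (out three) (λ ())
                                                      ∷ edge≢edge (out one) (into three) (λ ()) ∷ [])
    ∷ (edge≢edge (into one) (out three) (λ ()) ∷ edge≢edge (into one) (into three) (λ ()) ∷ [])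
    ∷ (edge≢edge (out three) (into three) (opposite three) ∷ [])
    ∷ []
    ∷ []

  star-injective : Injective _≡_ _≡_ (lookup (star σ v))
  star-injective = lookup-injective star-unique _ _

colourClass : Total5Colouring → Colour → Subset 13
colourClass σ j = tabulate (does ∘ λ v → vcol σ v ≟ j)

module _ (σ : Total5Colouring) (j : Colour) where
  classSize≡∑ : classSize σ j ≡ ∑[ v < 13 ] [ vcol σ v ≟ j ]
  classSize≡∑ = length-filter-tabulate (λ v → vcol σ v ≟ j) id

  ∣colourClass∣ : ∣ colourClass σ j ∣ ≡ classSize σ j
  ∣colourClass∣ = trans (∣tabulate∣ (λ v → vcol σ v ≟ j)) (sym classSize≡∑)

  ∈-colourClass⁻ : ∀ {v} → v ∈ colourClass σ j → vcol σ v ≡ j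
  ∈-colourClass⁻ = ∈-tabulate⁻ (λ v → vcol σ v ≟ j)

  colourClass-independent : Independent (colourClass σ j)
  colourClass-independent v s (v∈ , w∈) =
    vertexProper σ v _ ((v , s) , inj₁ (refl , refl)) (trans (∈-colourClass⁻ v∈) (sym (∈-colourClass⁻ w∈)))

  private
    blocked : ∀ {w e} → Incident w e → w ∈ colourClass σ j → ecol σ e ≢ j
    blocked {w} {e} w∼e w∈ e∈ = incidProper σ w e w∼e (trans (∈-colourClass⁻ w∈) (sym e∈))

  colourClass-non-surrounding : ∀ v → ¬ Surrounds (colourClass σ j) v
  colourClass-non-surrounding v nbrs with injective⇒surjective (star-injective σ v) j
  ... | 0F , v∈ = vertexProper σ v _ ((v , one) , inj₁ (refl , refl))
                    (trans v∈ (sym (∈-colourClass⁻ (proj₁ (nbrs one)))))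
  ... | 1F , e∈ = blocked (inj₂ refl) (proj₁ (nbrs one)) e∈
  ... | 2F , e∈ = blocked (inj₁ refl) (proj₂ (nbrs one)) e∈
  ... | 3F , e∈ = blocked (inj₂ refl) (proj₁ (nbrs three)) e∈
  ... | 4F , e∈ = blocked (inj₁ refl) (proj₂ (nbrs three)) e∈

  classSize≤4 : classSize σ j ≤ 4
  classSize≤4 = subst (_≤ 4) ∣colourClass∣
    (∣independent-non-surrounding∣≤4 _ colourClass-independent colourClass-non-surrounding)

  edgeClassSize : Step → ℕ
  edgeClassSize s = ∑[ v < 13 ] [ ecol σ (v , s) ≟ j ]

  -- The edge (v , s) lies in the stars of both v and v ⊕ s, hence the factor 2.
  classSize+2*edgeClassSize≡13 : classSize σ j + 2 * (edgeClassSize one + edgeClassSize three) ≡ 13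
  classSize+2*edgeClassSize≡13 = begin
    classSize σ j + 2 * (E₁ + E₃)                      ≡⟨ cong (_+ 2 * (E₁ + E₃)) classSize≡∑ ⟩
    V + 2 * (E₁ + E₃)                                  ≡⟨ double V E₁ E₃ ⟩
    V + (E₁ + (E₁ + (E₃ + (E₃ + 0))))                  ≡⟨ cong₂ (λ a b → V + (E₁ + (a + (E₃ + (b + 0)))))
                                                                (∑-⊖ one (λ v → [ ecol σ (v , one) ≟ j ]))
                                                                (∑-⊖ three (λ v → [ ecol σ (v , three) ≟ j ])) ⟨
    ∑[ k < 5 ] ∑[ v < 13 ] [ lookup (star σ v) k ≟ j ] ≡⟨ ∑-comm (λ k v → [ lookup (star σ v) k ≟ j ]) ⟩
    ∑[ v < 13 ] ∑[ k < 5 ] [ lookup (star σ v) k ≟ j ] ≡⟨ sum-cong-≗ (λ v → injective⇒∑[fk≟j]≡1 (star-injective σ v) j) ⟩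
    13                                                 ∎
    where
    open ≡-Reasoning
    V = ∑[ v < 13 ] [ vcol σ v ≟ j ]
    E₁ = edgeClassSize one
    E₃ = edgeClassSize three
    double : ∀ a b c → a + 2 * (b + c) ≡ a + (b + (b + (c + (c + 0))))
    double = solve-∀

classSizes-sum : ∀ σ → classSize σ 0F + classSize σ 1F + classSize σ 2F + classSize σ 3F + classSize σ 4F ≡ 13
classSizes-sum σ = begin
  classSize σ 0F + classSize σ 1F + classSize σ 2F + classSize σ 3F + classSize σ 4F
    ≡⟨ reassociate (classSize σ 0F) (classSize σ 1F) (classSize σ 2F) (classSize σ 3F) (classSize σ 4F) ⟩
  ∑[ j < 5 ] classSize σ j
    ≡⟨ sum-cong-≗ (classSize≡∑ σ) ⟩
  ∑[ j < 5 ] ∑[ v < 13 ] [ vcol σ v ≟ j ]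
    ≡⟨ ∑-comm (λ j v → [ vcol σ v ≟ j ]) ⟩
  ∑[ v < 13 ] ∑[ j < 5 ] [ vcol σ v ≟ j ]
    ≡⟨ sum-cong-≗ (λ v → ∑[i≟j]≡1 (vcol σ v)) ⟩
  13 ∎
  where
  open ≡-Reasoning
  reassociate : ∀ a b c d e → a + b + c + d + e ≡ a + (b + (c + (d + (e + 0))))
  reassociate = solve-∀

odd≤4 : ∀ {n} k → n ≤ 4 → n + 2 * k ≡ 13 → n ≡ 1 ⊎ n ≡ 3
odd≤4 {0} k _ eq = contradiction eq (even≢odd k 6)
odd≤4 {1} _ _ _  = inj₁ refl
odd≤4 {2} k _ eq = contradiction (suc-injective (suc-injective eq)) (even≢odd k 5)
odd≤4 {3} _ _ _  = inj₂ refl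
odd≤4 {4} k _ eq = contradiction (suc-injective (suc-injective (suc-injective (suc-injective eq)))) (even≢odd k 4)
odd≤4 {suc (suc (suc (suc (suc _))))} _ (s≤s (s≤s (s≤s (s≤s ())))) _

classSize-odd : ∀ σ j → classSize σ j ≡ 1 ⊎ classSize σ j ≡ 3
classSize-odd σ j = odd≤4 (edgeClassSize σ j one + edgeClassSize σ j three) (classSize≤4 σ j) (classSize+2*edgeClassSize≡13 σ j)

sorted-sizes : ∀ {a b c d e} → a ≡ 1 ⊎ a ≡ 3 → b ≡ 1 ⊎ b ≡ 3 → c ≡ 1 ⊎ c ≡ 3 → d ≡ 1 ⊎ d ≡ 3 → e ≡ 1 ⊎ e ≡ 3 →
               a ≥ b → b ≥ c → c ≥ d → d ≥ e → a + b + c + d + e ≡ 13 →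
               a ≡ 3 × b ≡ 3 × c ≡ 3 × d ≡ 3 × e ≡ 1
sorted-sizes (inj₂ refl) (inj₂ refl) (inj₂ refl) (inj₂ refl) (inj₁ refl) _ _ _ _ _ = refl , refl , refl , refl , refl
sorted-sizes (inj₂ refl) (inj₂ refl) (inj₂ refl) (inj₂ refl) (inj₂ refl) _ _ _ _ ()
sorted-sizes (inj₂ refl) (inj₂ refl) (inj₂ refl) (inj₁ refl) (inj₁ refl) _ _ _ _ ()
sorted-sizes (inj₂ refl) (inj₂ refl) (inj₁ refl) (inj₁ refl) (inj₁ refl) _ _ _ _ ()
sorted-sizes (inj₂ refl) (inj₁ refl) (inj₁ refl) (inj₁ refl) (inj₁ refl) _ _ _ _ ()
sorted-sizes (inj₁ refl) (inj₁ refl) (inj₁ refl) (inj₁ refl) (inj₁ refl) _ _ _ _ ()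
sorted-sizes _ _ _ (inj₁ refl) (inj₂ refl) _ _ _ (s≤s ()) _
sorted-sizes _ _ (inj₁ refl) (inj₂ refl) _ _ _ (s≤s ()) _ _
sorted-sizes _ (inj₁ refl) (inj₂ refl) _ _ _ (s≤s ()) _ _ _
sorted-sizes (inj₁ refl) (inj₂ refl) _ _ _ (s≤s ()) _ _ _ _

lemma10 : (σ : Total5Colouring) →
          classSize σ zero ≥ classSize σ (suc zero) →
          classSize σ (suc zero) ≥ classSize σ (suc (suc zero)) →
          classSize σ (suc (suc zero)) ≥ classSize σ (suc (suc (suc zero))) →
          classSize σ (suc (suc (suc zero))) ≥ classSize σ (suc (suc (suc (suc zero)))) →
          (classSize σ zero ≡ 3) × (classSize σ (suc zero) ≡ 3) ×
          (classSize σ (suc (suc zero)) ≡ 3) × (classSize σ (suc (suc (suc zero))) ≡ 3) ×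
          (classSize σ (suc (suc (suc (suc zero)))) ≡ 1)
lemma10 σ h₁ h₂ h₃ h₄ =
  sorted-sizes (classSize-odd σ 0F) (classSize-odd σ 1F) (classSize-odd σ 2F) (classSize-odd σ 3F) (classSize-odd σ 4F)
    h₁ h₂ h₃ h₄ (classSizes-sum σ)
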